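{- Let $n$ be odd and let $L$ be a reduced Latin square of order $n$ with rows $\sigma_1,\dots,\sigma_n$ and columns $\pi_1,\dots,\pi_n$ (viewed as permutations). Let $\alpha\in S_n$, $j\in[n]$ and $\Theta=(\alpha,\ \alpha\pi_j\sigma_{\alpha^{ -1}(1)}^{ -1},\ \alpha\pi_j)$. Then $$\mathrm{par}(\Theta(L))=\mathrm{sgn}(\sigma_{\alpha^{ -1}(1)})\,\mathrm{sgn}(\pi_j)\,\mathrm{par}(L).$$
   Context: A Latin square of order $n$ is an $n\times n$ array with entries in $[n]$ in which each symbol appears exactly once in each row and column. Rows and columns are viewed as permutations in $S_n$ via the convention: symbol $i$ in the $j$th place of a row (or column) $\pi$ means $\pi(i)=j$; permutations are composed right to left. A Latin square is reduced if its first row and first column are the identity permutation. An isotopism $(\alpha,\beta,\gamma)\in S_n^3$ acts by moving the row in position $r$ to position $\alpha(r)$, the column in position $c$ to position $\beta(c)$, and replacing each symbol $s$ by $\gamma(s)$. $\mathrm{sgn}$ is the sign of a permutation, and $\mathrm{par}(L)$ is the product of the signs of all rows and all columns of $L$. -}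

module Defs where

open import Data.Nat using (ℕ; zero; suc)
open import Data.Fin using (Fin; zero; suc; _<_; _<?_)
open import Data.Fin.Permutation using (Permutation; _⟨$⟩ʳ_; _⟨$⟩ˡ_; _∘ₚ_; flip; inverseʳ; inverseˡ)
open import Data.List using (List; []; _∷_; map; foldr; allFin; filter; length; concatMap)
open import Data.Product using (_×_; _,_; proj₁; proj₂)
open import Data.Sign using (Sign) renaming (_*_ to _*ˢ_)
open import Relation.Nullary.Decidable using (_×-dec_)
open import Relation.Binary.PropositionalEquality using (_≡_; refl; cong; trans)

Perm : ℕ → Set
Perm n = Permutation n n

-- Right-to-left composition: (p · q)(i) = p (q i).
-- (stdlib's _∘ₚ_ is diagrammatic: (q ∘ₚ p)(i) = p (q i).)
infixr 9 _·_
_·_ : ∀ {n} → Perm n → Perm n → Perm n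
p · q = q ∘ₚ p

_⁻¹ : ∀ {n} → Perm n → Perm n
p ⁻¹ = flip p

inversions : ∀ {n} → Perm n → ℕ
inversions {n} p =
  length (filter (λ ij → (proj₁ ij <? proj₂ ij) ×-dec ((p ⟨$⟩ʳ proj₂ ij) <? (p ⟨$⟩ʳ proj₁ ij)))
                 (concatMap (λ i → map (λ j → (i , j)) (allFin n)) (allFin n)))

signOfParity : ℕ → Sign
signOfParity zero = Sign.+
signOfParity (suc zero) = Sign.-
signOfParity (suc (suc k)) = signOfParity k

sgn : ∀ {n} → Perm n → Sign
sgn p = signOfParity (inversions p)

-- Latin square of order n: an array entry r c (row r, column c) with symbols in Fin n,
-- together with its rows and columns as permutations, under the convention
-- "symbol i in the j-th place of a row/column π means π(i) = j".
-- The fields row-ok / col-ok force each row/column to contain each symbol exactly once,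
-- and they determine row r and col c uniquely from entry.
record LatinSquare (n : ℕ) : Set where
  field
    entry  : Fin n → Fin n → Fin n
    row    : Fin n → Perm n
    col    : Fin n → Perm n
    row-ok : ∀ r i → entry r (row r ⟨$⟩ʳ i) ≡ i
    col-ok : ∀ c i → entry (col c ⟨$⟩ʳ i) c ≡ i
open LatinSquare public

Reduced : ∀ {n} → LatinSquare (suc n) → Set
Reduced L = (∀ i → row L zero ⟨$⟩ʳ i ≡ i) × (∀ i → col L zero ⟨$⟩ʳ i ≡ i)

-- Isotopism (α, β, γ): row in position r moves to α(r), column in position c to β(c),
-- symbol s replaced by γ(s).  New entry at (α r, β c) is γ (entry r c).
Isotopism : ℕ → Set
Isotopism n = Perm n × Perm n × Perm n

private
  cancel : ∀ {n} (p : Perm n) {x y} → x ≡ p ⟨$⟩ʳ y → p ⟨$⟩ˡ x ≡ y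
  cancel p refl = inverseˡ p

applyIso : ∀ {n} → Isotopism n → LatinSquare n → LatinSquare n
applyIso (α , β , γ) L = record
  { entry  = λ r c → γ ⟨$⟩ʳ entry L (α ⟨$⟩ˡ r) (β ⟨$⟩ˡ c)
  ; row    = λ r → β · row L (α ⟨$⟩ˡ r) · γ ⁻¹
  ; col    = λ c → α · col L (β ⟨$⟩ˡ c) · γ ⁻¹
  ; row-ok = λ r i → trans (cong (γ ⟨$⟩ʳ_) (trans (cong (entry L (α ⟨$⟩ˡ r)) (inverseˡ β))
                                                  (row-ok L (α ⟨$⟩ˡ r) (γ ⟨$⟩ˡ i))))
                           (inverseʳ γ)
  ; col-ok = λ c i → trans (cong (γ ⟨$⟩ʳ_) (trans (cong (λ x → entry L x (β ⟨$⟩ˡ c)) (inverseˡ α))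
                                                  (col-ok L (β ⟨$⟩ˡ c) (γ ⟨$⟩ˡ i))))
                           (inverseʳ γ)
  }

prodSign : List Sign → Sign
prodSign = foldr _*ˢ_ Sign.+

par : ∀ {n} → LatinSquare n → Sign
par {n} L = prodSign (map (λ r → sgn (row L r)) (allFin n)) *ˢ prodSign (map (λ c → sgn (col L c)) (allFin n))

-- Row r of Θ(L), for Θ = (α, β, γ), is β σ γ⁻¹ where σ is the row of L in
-- position α⁻¹(r); column c is α π γ⁻¹ where π is the column in position
-- β⁻¹(c).  Since sgn is a homomorphism S_n → {±1}, every row sign gains the
-- factor sgn β sgn γ and every column sign the factor sgn α sgn γ; for odd n
-- each factor survives the n-fold product exactly once, so
--     par(Θ(L)) = sgn α · sgn β · par(L)              (par-isotopism).
-- Lemma 2.5 is the instance β = α π_j σ⁻¹, γ = α π_j, for which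
-- sgn α · sgn β = sgn σ · sgn π_j.

module Submission where

open import Defs
open import Data.Nat using (ℕ; suc; _%_)
open import Data.Fin using (Fin; zero)
open import Data.Fin.Permutation using (_⟨$⟩ˡ_)
open import Data.Product using (_,_)
open import Data.Sign using () renaming (_*_ to _*ˢ_)
open import Relation.Binary.PropositionalEquality using (_≡_)

open import Data.Nat as ℕ using ()
open import Data.Fin as Fin using (_<_; _<?_; _≟_)
open import Data.Fin.Properties using (<-asym; <-irrefl; <-cmp)
open import Data.Fin.Permutation using (_⟨$⟩ʳ_; inverseˡ; flip)
open import Data.Sign using (Sign)
open import Data.Sign.Properties
  using (*-commutativeMonoid; *-commutativeSemigroup; *-assoc; *-identityʳ; *-cancelʳ-≡; s*s≡+)
open import Algebra.Properties.CommutativeMonoid.Sum *-commutativeMonoid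
  using (∑-distrib-+; ∑-comm; ∑-permute; sum-cong-≗) renaming (sum to ∏)
open import Algebra.Properties.CommutativeSemigroup *-commutativeSemigroup using (interchange)
open import Algebra.Solver.CommutativeMonoid *-commutativeMonoid using (solve; _⊕_; _⊜_)
open import Data.Bool using (Bool; true; false; _∧_; if_then_else_)
open import Data.List using (List; []; _∷_; _++_; map; filter; length; concatMap; allFin; tabulate)
open import Data.List.Properties using (map-++; map-tabulate; map-cong; map-∘)
open import Data.Product using (_×_; proj₁; proj₂)
open import Data.Empty using (⊥-elim)
open import Relation.Nullary using (Dec; yes; no; does; ¬_)
open import Relation.Nullary.Decidable using (dec-true; dec-false; _×-dec_)
open import Relation.Binary using (Tri; tri<; tri≈; tri>)
open import Relation.Binary.PropositionalEquality
  using (_≢_; refl; sym; trans; cong; cong₂; module ≡-Reasoning)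

open ≡-Reasoning

private
  infixl 7 _*_
  _*_ : Sign → Sign → Sign
  _*_ = _*ˢ_

  variable
    n : ℕ

square-cancels : ∀ a x → (a * a) * x ≡ x
square-cancels a x = cong (_* x) (s*s≡+ a)

product-trivial : ∀ {a b} → a * b ≡ Sign.+ → a ≡ b
product-trivial {a} {b} ab≡+ = *-cancelʳ-≡ b a b (trans ab≡+ (sym (s*s≡+ b)))

signIf : Bool → Sign
signIf true  = Sign.-
signIf false = Sign.+

signIf-∧ : ∀ x y → signIf (x ∧ y) ≡ (if x then signIf y else Sign.+)
signIf-∧ true  y = refl
signIf-∧ false y = refl

permute-≢ : (p : Perm n) {a b : Fin n} → a ≢ b → p ⟨$⟩ʳ a ≢ p ⟨$⟩ʳ b
permute-≢ p a≢b pa≡pb =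
  a≢b (trans (sym (inverseˡ p)) (trans (cong (p ⟨$⟩ˡ_) pa≡pb) (inverseˡ p)))

SignMatrix : ℕ → Set
SignMatrix n = Fin n → Fin n → Sign

IsSymmetric : SignMatrix n → Set
IsSymmetric X = ∀ a b → X a b ≡ X b a

upper : SignMatrix n → SignMatrix n
upper G i j with <-cmp i j
... | tri< _ _ _ = G i j
... | tri≈ _ _ _ = Sign.+
... | tri> _ _ _ = Sign.+

upper-< : (G : SignMatrix n) {a b : Fin n} → a < b → upper G a b ≡ G a b
upper-< G {a} {b} a<b with <-cmp a b
... | tri< _ _ _   = refl
... | tri≈ a≮b _ _ = ⊥-elim (a≮b a<b)
... | tri> a≮b _ _ = ⊥-elim (a≮b a<b)

upper-≮ : (G : SignMatrix n) {a b : Fin n} → ¬ a < b → upper G a b ≡ Sign.+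
upper-≮ G {a} {b} a≮b with <-cmp a b
... | tri< a<b _ _ = ⊥-elim (a≮b a<b)
... | tri≈ _ _ _   = refl
... | tri> _ _ _   = refl

upper-diagonal : (G : SignMatrix n) (a : Fin n) → upper G a a ≡ Sign.+
upper-diagonal G a = upper-≮ G {a} {a} (<-irrefl refl)

-- Off the diagonal, exactly one of the entries (a, b) and (b, a) is upper.
upper-pair : (G : SignMatrix n) → IsSymmetric G → {a b : Fin n} → a ≢ b →
             upper G a b * upper G b a ≡ G a b
upper-pair G G-sym {a} {b} a≢b = by-order (<-cmp a b)
  where
  by-order : Tri (a < b) (a ≡ b) (b < a) → upper G a b * upper G b a ≡ G a b
  by-order (tri< a<b _ b≮a) = trans (cong₂ _*_ (upper-< G a<b) (upper-≮ G b≮a)) (*-identityʳ (G a b))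
  by-order (tri≈ _ a≡b _)   = ⊥-elim (a≢b a≡b)
  by-order (tri> a≮b _ b<a) = trans (cong₂ _*_ (upper-≮ G a≮b) (upper-< G b<a)) (G-sym b a)

upper-* : (F G : SignMatrix n) (i j : Fin n) →
          upper (λ a b → F a b * G a b) i j ≡ upper F i j * upper G i j
upper-* F G i j with <-cmp i j
... | tri< _ _ _ = refl
... | tri≈ _ _ _ = refl
... | tri> _ _ _ = refl

upper-cong-< : (F G : SignMatrix n) → (∀ {a b} → a < b → F a b ≡ G a b) →
               ∀ i j → upper F i j ≡ upper G i j
upper-cong-< F G F≡G i j = by-order (<-cmp i j)
  where
  by-order : Tri (i < j) (i ≡ j) (j < i) → upper F i j ≡ upper G i j
  by-order (tri< i<j _ _) = trans (upper-< F i<j) (trans (F≡G i<j) (sym (upper-< G i<j)))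
  by-order (tri≈ i≮j _ _) = trans (upper-≮ F i≮j) (sym (upper-≮ G i≮j))
  by-order (tri> i≮j _ _) = trans (upper-≮ F i≮j) (sym (upper-≮ G i≮j))

upper-as-if : (G : SignMatrix n) (i j : Fin n) →
              upper G i j ≡ (if does (i <? j) then G i j else Sign.+)
upper-as-if G i j = by-order (<-cmp i j)
  where
  restrict : Bool → Sign
  restrict b = if b then G i j else Sign.+
  by-order : Tri (i < j) (i ≡ j) (j < i) → upper G i j ≡ restrict (does (i <? j))
  by-order (tri< i<j _ _) = trans (upper-< G i<j) (cong restrict (sym (dec-true (i <? j) i<j)))
  by-order (tri≈ i≮j _ _) = trans (upper-≮ G i≮j) (cong restrict (sym (dec-false (i <? j) i≮j)))
  by-order (tri> i≮j _ _) = trans (upper-≮ G i≮j) (cong restrict (sym (dec-false (i <? j) i≮j)))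

∏∏ : SignMatrix n → Sign
∏∏ X = ∏ (λ i → ∏ (X i))

∏∏-cong : {X Y : SignMatrix n} → (∀ i j → X i j ≡ Y i j) → ∏∏ X ≡ ∏∏ Y
∏∏-cong X≡Y = sum-cong-≗ (λ i → sum-cong-≗ (X≡Y i))

∏∏-distrib : (X Y : SignMatrix n) → ∏∏ (λ i j → X i j * Y i j) ≡ ∏∏ X * ∏∏ Y
∏∏-distrib X Y = trans (sum-cong-≗ (λ i → ∑-distrib-+ (X i) (Y i)))
                       (∑-distrib-+ (λ i → ∏ (X i)) (λ i → ∏ (Y i)))

∏∏-transpose : (X : SignMatrix n) → ∏∏ X ≡ ∏∏ (λ i j → X j i)
∏∏-transpose = ∑-comm

∏∏-permute : (X : SignMatrix n) (q : Perm n) → ∏∏ X ≡ ∏∏ (λ i j → X (q ⟨$⟩ʳ i) (q ⟨$⟩ʳ j))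
∏∏-permute X q = trans (sum-cong-≗ (λ a → ∑-permute (X a) q))
                       (∑-permute (λ a → ∏ (λ j → X a (q ⟨$⟩ʳ j))) q)

symmetric-from-pairs : (X : SignMatrix n) → (∀ a b → a ≢ b → X a b * X b a ≡ Sign.+) →
                       IsSymmetric X
symmetric-from-pairs X pairs a b with a ≟ b
... | yes refl = refl
... | no  a≢b  = product-trivial (pairs a b a≢b)

-- Key fact: a symmetric matrix with trivial diagonal has total product +,
-- because its lower half is the transpose of its upper half.
symmetric-total : (X : SignMatrix n) → IsSymmetric X → (∀ a → X a a ≡ Sign.+) →
                  ∏∏ X ≡ Sign.+
symmetric-total X X-sym X-diag = begin
  ∏∏ X                                        ≡⟨ ∏∏-cong halves ⟩
  ∏∏ (λ i j → upper X i j * upper X j i)      ≡⟨ ∏∏-distrib (upper X) (λ i j → upper X j i) ⟩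
  ∏∏ (upper X) * ∏∏ (λ i j → upper X j i)     ≡⟨ cong (∏∏ (upper X) *_) (∏∏-transpose (upper X)) ⟨
  ∏∏ (upper X) * ∏∏ (upper X)                 ≡⟨ s*s≡+ (∏∏ (upper X)) ⟩
  Sign.+                                      ∎
  where
  halves : ∀ i j → X i j ≡ upper X i j * upper X j i
  halves i j with i ≟ j
  ... | yes refl = trans (X-diag i) (sym (cong₂ _*_ (upper-diagonal X i) (upper-diagonal X i)))
  ... | no  i≢j  = sym (upper-pair X X-sym i≢j)

upper-relabel : (X : SignMatrix n) → IsSymmetric X → (q : Perm n) →
                ∏∏ (λ i j → upper X (q ⟨$⟩ʳ i) (q ⟨$⟩ʳ j))
                  ≡ ∏∏ (upper (λ i j → X (q ⟨$⟩ʳ i) (q ⟨$⟩ʳ j)))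
upper-relabel X X-sym q =
  product-trivial (trans (sym (∏∏-distrib A B)) (symmetric-total Y Y-sym Y-diag))
  where
  Xq : SignMatrix _
  Xq i j = X (q ⟨$⟩ʳ i) (q ⟨$⟩ʳ j)
  Xq-sym : IsSymmetric Xq
  Xq-sym a b = X-sym (q ⟨$⟩ʳ a) (q ⟨$⟩ʳ b)
  A B Y : SignMatrix _
  A i j = upper X (q ⟨$⟩ʳ i) (q ⟨$⟩ʳ j)
  B = upper Xq
  Y i j = A i j * B i j

  -- Each of A and B has mirrored entries multiplying to X(q i, q j).
  Y-pairs : ∀ i j → i ≢ j → Y i j * Y j i ≡ Sign.+
  Y-pairs i j i≢j = begin
    (A i j * B i j) * (A j i * B j i)   ≡⟨ interchange (A i j) (B i j) (A j i) (B j i) ⟩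
    (A i j * A j i) * (B i j * B j i)   ≡⟨ cong₂ _*_ (upper-pair X X-sym (permute-≢ q i≢j))
                                                     (upper-pair Xq Xq-sym i≢j) ⟩
    Xq i j * Xq i j                     ≡⟨ s*s≡+ (Xq i j) ⟩
    Sign.+                              ∎

  Y-sym : IsSymmetric Y
  Y-sym = symmetric-from-pairs Y Y-pairs

  Y-diag : ∀ a → Y a a ≡ Sign.+
  Y-diag a = cong₂ _*_ (upper-diagonal X (q ⟨$⟩ʳ a)) (upper-diagonal Xq a)

signOfParity-suc : ∀ k → signOfParity (suc k) ≡ Sign.- * signOfParity k
signOfParity-suc ℕ.zero          = refl
signOfParity-suc (suc ℕ.zero)    = refl
signOfParity-suc (suc (suc k))   = signOfParity-suc k

parity-filter : {A : Set} {P : A → Set} (P? : ∀ x → Dec (P x)) (xs : List A) →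
                signOfParity (length (filter P? xs)) ≡ prodSign (map (λ x → signIf (does (P? x))) xs)
parity-filter P? []       = refl
parity-filter P? (x ∷ xs) with does (P? x)
... | true  = trans (signOfParity-suc (length (filter P? xs))) (cong (Sign.- *_) (parity-filter P? xs))
... | false = parity-filter P? xs

prodSign-++ : (xs ys : List Sign) → prodSign (xs ++ ys) ≡ prodSign xs * prodSign ys
prodSign-++ []       ys = refl
prodSign-++ (x ∷ xs) ys = trans (cong (x *_) (prodSign-++ xs ys)) (sym (*-assoc x _ _))

prodSign-concatMap : {A B : Set} (h : A → Sign) (g : B → List A) (xs : List B) →
                     prodSign (map h (concatMap g xs)) ≡ prodSign (map (λ x → prodSign (map h (g x))) xs)
prodSign-concatMap h g []       = refl
prodSign-concatMap h g (x ∷ xs) = begin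
  prodSign (map h (g x ++ concatMap g xs))             ≡⟨ cong prodSign (map-++ h (g x) (concatMap g xs)) ⟩
  prodSign (map h (g x) ++ map h (concatMap g xs))     ≡⟨ prodSign-++ (map h (g x)) _ ⟩
  prodSign (map h (g x)) * prodSign (map h (concatMap g xs))
                                                       ≡⟨ cong (prodSign (map h (g x)) *_) (prodSign-concatMap h g xs) ⟩
  prodSign (map h (g x)) * prodSign (map (λ y → prodSign (map h (g y))) xs) ∎

prodSign-tabulate : (h : Fin n → Sign) → prodSign (tabulate h) ≡ ∏ h
prodSign-tabulate {ℕ.zero}  h = refl
prodSign-tabulate {suc n}   h = cong (h zero *_) (prodSign-tabulate (λ i → h (Fin.suc i)))

prodSign-allFin : (h : Fin n → Sign) → prodSign (map h (allFin n)) ≡ ∏ h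
prodSign-allFin h = trans (cong prodSign (map-tabulate (λ i → i) h)) (prodSign-tabulate h)

pairsWith : Fin n → List (Fin n × Fin n)
pairsWith {n} i = map (λ j → (i , j)) (allFin n)

allPairs : (n : ℕ) → List (Fin n × Fin n)
allPairs n = concatMap pairsWith (allFin n)

prodSign-pairs : (h : Fin n × Fin n → Sign) → prodSign (map h (allPairs n)) ≡ ∏∏ (λ i j → h (i , j))
prodSign-pairs {n} h = begin
  prodSign (map h (allPairs n))                          ≡⟨ prodSign-concatMap h pairsWith (allFin n) ⟩
  prodSign (map (λ i → prodSign (map h (pairsWith i))) (allFin n))
                                                         ≡⟨ cong prodSign (map-cong rowProduct (allFin n)) ⟩
  prodSign (map (λ i → ∏ (λ j → h (i , j))) (allFin n))  ≡⟨ prodSign-allFin (λ i → ∏ (λ j → h (i , j))) ⟩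
  ∏∏ (λ i j → h (i , j))                                 ∎
  where
  rowProduct : ∀ i → prodSign (map h (pairsWith i)) ≡ ∏ (λ j → h (i , j))
  rowProduct i = trans (cong prodSign (sym (map-∘ (allFin n)))) (prodSign-allFin (λ j → h (i , j)))

descent : Fin n → Fin n → Sign
descent a b = signIf (does (b <? a))

descent-< : {a b : Fin n} → a < b → descent a b ≡ Sign.+
descent-< {a = a} {b} a<b = cong signIf (dec-false (b <? a) (<-asym a<b))

descent-> : {a b : Fin n} → b < a → descent a b ≡ Sign.-
descent-> {a = a} {b} b<a = cong signIf (dec-true (b <? a) b<a)

descent-pair : {a b : Fin n} → a ≢ b → descent a b * descent b a ≡ Sign.-
descent-pair {a = a} {b} a≢b = by-order (<-cmp a b)
  where
  by-order : Tri (a < b) (a ≡ b) (b < a) → descent a b * descent b a ≡ Sign.-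
  by-order (tri< a<b _ _) = cong₂ _*_ (descent-< a<b) (descent-> a<b)
  by-order (tri≈ _ a≡b _) = ⊥-elim (a≢b a≡b)
  by-order (tri> _ _ b<a) = cong₂ _*_ (descent-> b<a) (descent-< b<a)

reversal : (Fin n → Fin n) → SignMatrix n
reversal f a b = descent (f a) (f b)

sgn-as-∏∏ : (p : Perm n) → sgn p ≡ ∏∏ (upper (reversal (p ⟨$⟩ʳ_)))
sgn-as-∏∏ {n} p = begin
  sgn p                                          ≡⟨ parity-filter inverted (allPairs n) ⟩
  prodSign (map (λ ij → signIf (does (inverted ij))) (allPairs n))
                                                 ≡⟨ prodSign-pairs (λ ij → signIf (does (inverted ij))) ⟩
  ∏∏ (λ i j → signIf (does (inverted (i , j))))  ≡⟨ ∏∏-cong entrywise ⟩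
  ∏∏ (upper (reversal (p ⟨$⟩ʳ_)))                ∎
  where
  inverted : (ij : Fin n × Fin n) → Dec (proj₁ ij < proj₂ ij × p ⟨$⟩ʳ proj₂ ij < p ⟨$⟩ʳ proj₁ ij)
  inverted ij = (proj₁ ij <? proj₂ ij) ×-dec ((p ⟨$⟩ʳ proj₂ ij) <? (p ⟨$⟩ʳ proj₁ ij))
  entrywise : ∀ i j → signIf (does (inverted (i , j))) ≡ upper (reversal (p ⟨$⟩ʳ_)) i j
  entrywise i j = trans (signIf-∧ (does (i <? j)) _) (sym (upper-as-if (reversal (p ⟨$⟩ʳ_)) i j))

-- relative f a b is − when f changes the relative order of a and b; for a
-- permutation this depends only on the unordered pair {a, b}.
relative : (Fin n → Fin n) → SignMatrix n
relative f a b = reversal f a b * descent a b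

relative-symmetric : (p : Perm n) → IsSymmetric (relative (p ⟨$⟩ʳ_))
relative-symmetric p = symmetric-from-pairs (relative (p ⟨$⟩ʳ_)) pairs
  where
  r : SignMatrix _
  r = reversal (p ⟨$⟩ʳ_)
  pairs : ∀ a b → a ≢ b → relative (p ⟨$⟩ʳ_) a b * relative (p ⟨$⟩ʳ_) b a ≡ Sign.+
  pairs a b a≢b = begin
    (r a b * descent a b) * (r b a * descent b a)  ≡⟨ interchange (r a b) (descent a b) (r b a) (descent b a) ⟩
    (r a b * r b a) * (descent a b * descent b a)  ≡⟨ cong₂ _*_ (descent-pair (permute-≢ p a≢b)) (descent-pair a≢b) ⟩
    Sign.- * Sign.-                                ≡⟨⟩
    Sign.+                                         ∎

-- Above the diagonal descent is +, so relative and reversal agree there.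
upper-relative : (f : Fin n → Fin n) → ∀ i j → upper (relative f) i j ≡ upper (reversal f) i j
upper-relative f = upper-cong-< (relative f) (reversal f) ascending
  where
  ascending : ∀ {a b} → a < b → relative f a b ≡ reversal f a b
  ascending {a} {b} a<b = trans (cong (reversal f a b *_) (descent-< a<b)) (*-identityʳ (reversal f a b))

reversal-compose : (p q : Perm n) → ∀ i j →
  reversal ((p · q) ⟨$⟩ʳ_) i j ≡ relative (p ⟨$⟩ʳ_) (q ⟨$⟩ʳ i) (q ⟨$⟩ʳ j) * reversal (q ⟨$⟩ʳ_) i j
reversal-compose p q i j = begin
  x              ≡⟨ *-identityʳ x ⟨
  x * Sign.+     ≡⟨ cong (x *_) (s*s≡+ y) ⟨
  x * (y * y)    ≡⟨ *-assoc x y y ⟨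
  (x * y) * y    ∎
  where
  x y : Sign
  x = reversal (p ⟨$⟩ʳ_) (q ⟨$⟩ʳ i) (q ⟨$⟩ʳ j)
  y = reversal (q ⟨$⟩ʳ_) i j

-- sgn is a homomorphism: the reversals of p · q are those of q times the
-- relative order changes of p, relabelled by q.
sgn-homomorphic : (p q : Perm n) → sgn (p · q) ≡ sgn p * sgn q
sgn-homomorphic p q = begin
  sgn (p · q)                                  ≡⟨ sgn-as-∏∏ (p · q) ⟩
  ∏∏ (upper (reversal ((p · q) ⟨$⟩ʳ_)))        ≡⟨ ∏∏-cong (upper-cong-< _ _ (λ {a} {b} _ → reversal-compose p q a b)) ⟩
  ∏∏ (upper (λ i j → Rq i j * Dq i j))         ≡⟨ ∏∏-cong (upper-* Rq Dq) ⟩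
  ∏∏ (λ i j → upper Rq i j * upper Dq i j)     ≡⟨ ∏∏-distrib (upper Rq) (upper Dq) ⟩
  ∏∏ (upper Rq) * ∏∏ (upper Dq)                ≡⟨ cong₂ _*_ (upper-relabel R (relative-symmetric p) q) (sgn-as-∏∏ q) ⟨
  ∏∏ (λ i j → upper R (q ⟨$⟩ʳ i) (q ⟨$⟩ʳ j)) * sgn q
                                               ≡⟨ cong (_* sgn q) (∏∏-permute (upper R) q) ⟨
  ∏∏ (upper R) * sgn q                         ≡⟨ cong (_* sgn q) (∏∏-cong (upper-relative (p ⟨$⟩ʳ_))) ⟩
  ∏∏ (upper (reversal (p ⟨$⟩ʳ_))) * sgn q      ≡⟨ cong (_* sgn q) (sgn-as-∏∏ p) ⟨
  sgn p * sgn q                                ∎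
  where
  R Rq Dq : SignMatrix _
  R = relative (p ⟨$⟩ʳ_)
  Rq i j = R (q ⟨$⟩ʳ i) (q ⟨$⟩ʳ j)
  Dq = reversal (q ⟨$⟩ʳ_)

sgn-cong : (p q : Perm n) → (∀ i → p ⟨$⟩ʳ i ≡ q ⟨$⟩ʳ i) → sgn p ≡ sgn q
sgn-cong p q p≗q = begin
  sgn p                             ≡⟨ sgn-as-∏∏ p ⟩
  ∏∏ (upper (reversal (p ⟨$⟩ʳ_)))   ≡⟨ ∏∏-cong (upper-cong-< _ _ (λ {a} {b} _ → cong₂ descent (p≗q a) (p≗q b))) ⟩
  ∏∏ (upper (reversal (q ⟨$⟩ʳ_)))   ≡⟨ sgn-as-∏∏ q ⟨
  sgn q                             ∎

-- An identity permutation r satisfies r ≗ r · r, hence sgn r = (sgn r)² = +.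
sgn-identity : (r : Perm n) → (∀ i → r ⟨$⟩ʳ i ≡ i) → sgn r ≡ Sign.+
sgn-identity r r≗id = begin
  sgn r            ≡⟨ sgn-cong r (r · r) (λ i → sym (cong (r ⟨$⟩ʳ_) (r≗id i))) ⟩
  sgn (r · r)      ≡⟨ sgn-homomorphic r r ⟩
  sgn r * sgn r    ≡⟨ s*s≡+ (sgn r) ⟩
  Sign.+           ∎

-- p⁻¹ · p is the identity, so sgn p⁻¹ sgn p = +.
sgn-inverse : (p : Perm n) → sgn (p ⁻¹) ≡ sgn p
sgn-inverse p = product-trivial (begin
  sgn (p ⁻¹) * sgn p   ≡⟨ sgn-homomorphic (p ⁻¹) p ⟨
  sgn (p ⁻¹ · p)       ≡⟨ sgn-identity (p ⁻¹ · p) (λ _ → inverseˡ p) ⟩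
  Sign.+               ∎)

-- The sign of x ρ y⁻¹, the shape of every row and column of an isotopic image.
sgn-conjugate : (x ρ y : Perm n) → sgn (x · ρ · y ⁻¹) ≡ (sgn x * sgn y) * sgn ρ
sgn-conjugate x ρ y = begin
  sgn (x · ρ · y ⁻¹)               ≡⟨ sgn-homomorphic x (ρ · y ⁻¹) ⟩
  sgn x * sgn (ρ · y ⁻¹)           ≡⟨ cong (sgn x *_) (sgn-homomorphic ρ (y ⁻¹)) ⟩
  sgn x * (sgn ρ * sgn (y ⁻¹))     ≡⟨ cong (λ s → sgn x * (sgn ρ * s)) (sgn-inverse y) ⟩
  sgn x * (sgn ρ * sgn y)          ≡⟨ solve 3 (λ a b c → a ⊕ (b ⊕ c) ⊜ (a ⊕ c) ⊕ b) refl (sgn x) (sgn ρ) (sgn y) ⟩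
  (sgn x * sgn y) * sgn ρ          ∎

∏-constant-odd : (c : Sign) → ∀ n → n % 2 ≡ 1 → ∏ {n} (λ _ → c) ≡ c
∏-constant-odd c (suc ℕ.zero)    _   = *-identityʳ c
∏-constant-odd c (suc (suc n))   odd = begin
  c * (c * ∏ {n} (λ _ → c))    ≡⟨ *-assoc c c _ ⟨
  (c * c) * ∏ {n} (λ _ → c)    ≡⟨ square-cancels c _ ⟩
  ∏ {n} (λ _ → c)              ≡⟨ ∏-constant-odd c n odd ⟩
  c                            ∎

∏-scaled-permuted : n % 2 ≡ 1 → (c : Sign) (τ : Perm n) (h : Fin n → Sign) →
                    ∏ (λ r → c * h (τ ⟨$⟩ʳ r)) ≡ c * ∏ h
∏-scaled-permuted {n} odd c τ h = begin
  ∏ (λ r → c * h (τ ⟨$⟩ʳ r))                  ≡⟨ ∑-distrib-+ {n} (λ _ → c) (λ r → h (τ ⟨$⟩ʳ r)) ⟩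
  ∏ {n} (λ _ → c) * ∏ (λ r → h (τ ⟨$⟩ʳ r))    ≡⟨ cong₂ _*_ (∏-constant-odd c n odd) (sym (∑-permute h τ)) ⟩
  c * ∏ h                                     ∎

rowSigns colSigns : LatinSquare n → Sign
rowSigns L = ∏ (λ r → sgn (row L r))
colSigns L = ∏ (λ c → sgn (col L c))

par-as-∏ : (L : LatinSquare n) → par L ≡ rowSigns L * colSigns L
par-as-∏ L = cong₂ _*_ (prodSign-allFin (λ r → sgn (row L r))) (prodSign-allFin (λ c → sgn (col L c)))

par-isotopism : n % 2 ≡ 1 → (α β γ : Perm n) (L : LatinSquare n) →
                par (applyIso (α , β , γ) L) ≡ (sgn α * sgn β) * par L
par-isotopism odd α β γ L = begin
  par (applyIso (α , β , γ) L)                        ≡⟨ par-as-∏ (applyIso (α , β , γ) L) ⟩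
  rowSigns (applyIso (α , β , γ) L) * colSigns (applyIso (α , β , γ) L)
                                                      ≡⟨ cong₂ _*_ rows cols ⟩
  ((sβ * sγ) * R) * ((sα * sγ) * C)                   ≡⟨ regroup sα sβ sγ R C ⟩
  (sγ * sγ) * ((sα * sβ) * (R * C))                   ≡⟨ square-cancels sγ _ ⟩
  (sα * sβ) * (R * C)                                 ≡⟨ cong ((sα * sβ) *_) (par-as-∏ L) ⟨
  (sα * sβ) * par L                                   ∎
  where
  sα sβ sγ R C : Sign
  sα = sgn α
  sβ = sgn β
  sγ = sgn γ
  R = rowSigns L
  C = colSigns L
  rows : rowSigns (applyIso (α , β , γ) L) ≡ (sβ * sγ) * R
  rows = trans (sum-cong-≗ (λ r → sgn-conjugate β (row L (α ⟨$⟩ˡ r)) γ))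
               (∏-scaled-permuted odd (sβ * sγ) (flip α) (λ r → sgn (row L r)))
  cols : colSigns (applyIso (α , β , γ) L) ≡ (sα * sγ) * C
  cols = trans (sum-cong-≗ (λ c → sgn-conjugate α (col L (β ⟨$⟩ˡ c)) γ))
               (∏-scaled-permuted odd (sα * sγ) (flip β) (λ c → sgn (col L c)))
  regroup : ∀ a b g r c → ((b * g) * r) * ((a * g) * c) ≡ (g * g) * ((a * b) * (r * c))
  regroup = solve 5 (λ a b g r c → ((b ⊕ g) ⊕ r) ⊕ ((a ⊕ g) ⊕ c) ⊜ (g ⊕ g) ⊕ ((a ⊕ b) ⊕ (r ⊕ c))) refl

lemma2p5 : (m : ℕ) → suc m % 2 ≡ 1 → (L : LatinSquare (suc m)) → Reduced L →
    (α : Perm (suc m)) (j : Fin (suc m)) →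
    par (applyIso (α , α · col L j · (row L (α ⟨$⟩ˡ zero)) ⁻¹ , α · col L j) L)
      ≡ sgn (row L (α ⟨$⟩ˡ zero)) *ˢ (sgn (col L j) *ˢ par L)
lemma2p5 m odd L _ α j = begin
  par (applyIso (α , α · π · σ ⁻¹ , α · π) L)          ≡⟨ par-isotopism odd α (α · π · σ ⁻¹) (α · π) L ⟩
  (sgn α * sgn (α · π · σ ⁻¹)) * par L                 ≡⟨ cong (λ s → (sgn α * s) * par L) (sgn-conjugate α π σ) ⟩
  (sgn α * ((sgn α * sgn σ) * sgn π)) * par L          ≡⟨ regroup (sgn α) (sgn σ) (sgn π) (par L) ⟩
  (sgn α * sgn α) * (sgn σ * (sgn π * par L))          ≡⟨ square-cancels (sgn α) _ ⟩
  sgn σ * (sgn π * par L)                              ∎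
  where
  σ π : Perm (suc m)
  σ = row L (α ⟨$⟩ˡ zero)
  π = col L j
  regroup : ∀ a s p P → (a * ((a * s) * p)) * P ≡ (a * a) * (s * (p * P))
  regroup = solve 4 (λ a s p P → (a ⊕ ((a ⊕ s) ⊕ p)) ⊕ P ⊜ (a ⊕ a) ⊕ (s ⊕ (p ⊕ P))) refl
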